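{- For every $f\in\mathrm{QSL}[\mathfrak{A}]$ and every $\alpha\in\mathbb{P}$, the $\mathrm{SL}[\mathfrak{A}]$ formula $\mathrm{atleast}_\alpha(f)$ has size at most $3\cdot|f|\cdot 2^{(|f|_p+1)^2}$; hence its size is in $\mathcal{O}(|f|)\cdot 2^{\mathcal{O}(|f|_p^2)}$.
   Context: $\mathfrak{A}$ is a set of predicates (sets of stack–heap states), $\mathbb{P}=\mathbb{Q}\cap[0,1]$. $\mathrm{SL}[\mathfrak{A}]$: $\varphi ::= \mathsf{true}\mid a\ (a\in\mathfrak{A})\mid\neg\varphi\mid\varphi\wedge\varphi\mid\varphi\vee\varphi\mid\exists x\colon\varphi\mid\forall x\colon\varphi\mid\varphi\star\varphi\mid\varphi\mathbin{ -\!\!\star}\varphi$. $\mathrm{QSL}[\mathfrak{A}]$: $f ::= [\varphi] \mid [b]\cdot f + [\neg b]\cdot f \mid q\cdot f+(1-q)\cdot f \mid f\cdot f\mid 1-f\mid \max(f,f)\mid\min(f,f)\mid \mathsf{S}x\colon f\mid \mathsf{J}x\colon f\mid f\star f\mid [\varphi]\mathbin{ -\!\!\star} f$ ($\varphi\in\mathrm{SL}[\mathfrak{A}]$, $b$ pure, $q\in\mathbb{P}$). Sizes: for SL, atoms and $\mathsf{true}$ have size $1$, $|\neg\varphi|=|\exists x\colon\varphi|=|\forall x\colon\varphi|=1+|\varphi|$, and binary connectives $\wedge,\vee,\star,\mathbin{ -\!\!\star}$ have size $1+|\varphi_1|+|\varphi_2|$. For QSL: $|[\varphi]|=|\varphi|$;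 $|[b]\cdot g+[\neg b]\cdot u|=1+|b|+|g|+|\neg b|+|u|$; $|q\cdot g+(1-q)\cdot u|=|g\cdot u|=|\max(g,u)|=|\min(g,u)|=|g\star u|=1+|g|+|u|$; $|1-g|=|\mathsf{S}x\colon g|=|\mathsf{J}x\colon g|=1+|g|$; $|[\varphi]\mathbin{ -\!\!\star} g|=1+|g|+|\varphi|$. Probabilistic size: $|[\varphi]|_p=0$; $|q\cdot g+(1-q)\cdot u|_p=|g\cdot u|_p=|g\star u|_p=1+|g|_p+|u|_p$; $|[b]\cdot g+[\neg b]\cdot u|_p=|\max(g,u)|_p=|\min(g,u)|_p=|g|_p+|u|_p$; $|1-g|_p=|\mathsf{S}x\colon g|_p=|\mathsf{J}x\colon g|_p=|[\varphi]\mathbin{ -\!\!\star} g|_p=|g|_p$. Evaluation set: $\mathrm{Eval}([\varphi])=\{0,1\}$; $\mathrm{Eval}([b]\cdot g+[\neg b]\cdot u)=\mathrm{Eval}(\max(g,u))=\mathrm{Eval}(\min(g,u))=\mathrm{Eval}(g)\cup\mathrm{Eval}(u)$; $\mathrm{Eval}(q\cdot g+(1-q)\cdot u)=\{q\beta+(1-q)\gamma\mid\beta\in\mathrm{Eval}(g),\gamma\in\mathrm{Eval}(u)\}$; $\mathrm{Eval}(g\cdot u)=\mathrm{Eval}(g\star u)=\{\beta\gamma\mid\beta\in\mathrm{Eval}(g),\gamma\in\mathrm{Eval}(u)\}$; $\mathrm{Eval}(1-g)=\{1-\beta\mid\beta\in\mathrm{Eval}(g)\}$; $\mathrm{Eval}(\mathsf{S}x\colon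 g)=\mathrm{Eval}(\mathsf{J}x\colon g)=\mathrm{Eval}([\varphi]\mathbin{ -\!\!\star} g)=\mathrm{Eval}(g)$. The formula $\mathrm{atleast}_\alpha(f)$ is constructed recursively: $\mathrm{atleast}_\alpha([\varphi])=\mathsf{true}$ if $\alpha=0$ and $\varphi$ otherwise; $\mathrm{atleast}_\alpha([b]\cdot g+[\neg b]\cdot u)=(b\wedge\mathrm{atleast}_\alpha(g))\vee(\neg b\wedge\mathrm{atleast}_\alpha(u))$; $\mathrm{atleast}_\alpha(q\cdot g+(1-q)\cdot u)=\bigvee\{\mathrm{atleast}_\beta(g)\wedge\mathrm{atleast}_\gamma(u)\mid \beta\in\mathrm{Eval}(g),\gamma\in\mathrm{Eval}(u), q\beta+(1-q)\gamma\ge\alpha\}$; $\mathrm{atleast}_\alpha(g\cdot u)$ is the same disjunction over $\beta\gamma\ge\alpha$; $\mathrm{atleast}_\alpha(1-g)=\mathsf{true}$ if $\alpha=0$ and $\neg\mathrm{atleast}_\delta(g)$ otherwise, where $\delta=\min\{\beta\in\mathrm{Eval}(g)\mid\beta>1-\alpha\}$; $\mathrm{atleast}_\alpha(\max(g,u))=\mathrm{atleast}_\alpha(g)\vee\mathrm{atleast}_\alpha(u)$; $\mathrm{atleast}_\alpha(\min(g,u))=\mathrm{atleast}_\alpha(g)\wedge\mathrm{atleast}_\alpha(u)$; $\mathrm{atleast}_\alpha(\mathsf{S}x\colon g)=\exists x\colon\mathrm{atleast}_\alpha(g)$; $\mathrm{atleast}_\alpha(\mathsf{J}x\colon g)=\forall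 x\colon\mathrm{atleast}_\alpha(g)$; $\mathrm{atleast}_\alpha(g\star u)=\bigvee\{\mathrm{atleast}_\beta(g)\star\mathrm{atleast}_\gamma(u)\mid\beta\in\mathrm{Eval}(g),\gamma\in\mathrm{Eval}(u),\beta\gamma\ge\alpha\}$; $\mathrm{atleast}_\alpha([\varphi]\mathbin{ -\!\!\star} g)=\varphi\mathbin{ -\!\!\star}\mathrm{atleast}_\alpha(g)$. -}

module Defs where

open import Data.Nat as ℕ using (ℕ; suc; _+_)
open import Data.Rational as Q using (ℚ; 0ℚ; 1ℚ; _⊓_)
open import Data.Rational.Properties using (_≟_; _≤?_; _<?_)
open import Data.List using (List; []; _∷_; map; filter; deduplicate; cartesianProduct; foldr)
open import Data.Product using (_×_; _,_; proj₁; proj₂)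
open import Relation.Nullary using (yes; no)

record ℙ : Set where
  constructor mkℙ
  field
    val  : ℚ
    0≤v  : 0ℚ Q.≤ val
    v≤1  : val Q.≤ 1ℚ
open ℙ public

data SL (A Var : Set) : Set where
  true : SL A Var
  atom : A → SL A Var
  ¬ₛ_  : SL A Var → SL A Var
  _∧ₛ_ : SL A Var → SL A Var → SL A Var
  _∨ₛ_ : SL A Var → SL A Var → SL A Var
  ∃ₛ   : Var → SL A Var → SL A Var
  ∀ₛ   : Var → SL A Var → SL A Var
  _⋆_  : SL A Var → SL A Var → SL A Var
  _-⋆_ : SL A Var → SL A Var → SL A Var

sizeSL : ∀ {A Var} → SL A Var → ℕ
sizeSL true       = 1
sizeSL (atom _)   = 1
sizeSL (¬ₛ φ)     = suc (sizeSL φ)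
sizeSL (φ ∧ₛ ψ)   = suc (sizeSL φ + sizeSL ψ)
sizeSL (φ ∨ₛ ψ)   = suc (sizeSL φ + sizeSL ψ)
sizeSL (∃ₛ _ φ)   = suc (sizeSL φ)
sizeSL (∀ₛ _ φ)   = suc (sizeSL φ)
sizeSL (φ ⋆ ψ)    = suc (sizeSL φ + sizeSL ψ)
sizeSL (φ -⋆ ψ)   = suc (sizeSL φ + sizeSL ψ)

data QSL (A Var : Set) (Pure : SL A Var → Set) : Set where
  ⟦_⟧     : SL A Var → QSL A Var Pure
  cond    : (b : SL A Var) → Pure b → QSL A Var Pure → QSL A Var Pure → QSL A Var Pure
  mix     : ℙ → QSL A Var Pure → QSL A Var Pure → QSL A Var Pure
  _·_     : QSL A Var Pure → QSL A Var Pure → QSL A Var Pure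
  1-_     : QSL A Var Pure → QSL A Var Pure
  max     : QSL A Var Pure → QSL A Var Pure → QSL A Var Pure
  min     : QSL A Var Pure → QSL A Var Pure → QSL A Var Pure
  S       : Var → QSL A Var Pure → QSL A Var Pure
  J       : Var → QSL A Var Pure → QSL A Var Pure
  _⋆q_    : QSL A Var Pure → QSL A Var Pure → QSL A Var Pure
  _-⋆q_   : SL A Var → QSL A Var Pure → QSL A Var Pure

module _ {A Var : Set} {Pure : SL A Var → Set} where

  size : QSL A Var Pure → ℕ
  size ⟦ φ ⟧          = sizeSL φ
  size (cond b _ g u) = suc (sizeSL b + size g + sizeSL (¬ₛ b) + size u)
  size (mix _ g u)    = suc (size g + size u)
  size (g · u)        = suc (size g + size u)
  size (1- g)         = suc (size g)
  size (max g u)      = suc (size g + size u)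
  size (min g u)      = suc (size g + size u)
  size (S _ g)        = suc (size g)
  size (J _ g)        = suc (size g)
  size (g ⋆q u)       = suc (size g + size u)
  size (φ -⋆q g)      = suc (size g + sizeSL φ)

  psize : QSL A Var Pure → ℕ
  psize ⟦ φ ⟧          = 0
  psize (cond b _ g u) = psize g + psize u
  psize (mix _ g u)    = suc (psize g + psize u)
  psize (g · u)        = suc (psize g + psize u)
  psize (1- g)         = psize g
  psize (max g u)      = psize g + psize u
  psize (min g u)      = psize g + psize u
  psize (S _ g)        = psize g
  psize (J _ g)        = psize g
  psize (g ⋆q u)       = suc (psize g + psize u)
  psize (φ -⋆q g)      = psize g

-- Finite sets of rationals represented as duplicate-free lists.
dedup : List ℚ → List ℚ
dedup = deduplicate _≟_

module _ {A Var : Set} {Pure : SL A Var → Set} where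

  Eval : QSL A Var Pure → List ℚ
  Eval ⟦ φ ⟧          = 0ℚ ∷ 1ℚ ∷ []
  Eval (cond b _ g u) = dedup (Data.List._++_ (Eval g) (Eval u))
  Eval (mix q g u)    = dedup (map (λ p → val q Q.* proj₁ p Q.+ (1ℚ Q.- val q) Q.* proj₂ p)
                                   (cartesianProduct (Eval g) (Eval u)))
  Eval (g · u)        = dedup (map (λ p → proj₁ p Q.* proj₂ p) (cartesianProduct (Eval g) (Eval u)))
  Eval (1- g)         = dedup (map (λ β → 1ℚ Q.- β) (Eval g))
  Eval (max g u)      = dedup (Data.List._++_ (Eval g) (Eval u))
  Eval (min g u)      = dedup (Data.List._++_ (Eval g) (Eval u))
  Eval (S _ g)        = Eval g
  Eval (J _ g)        = Eval g
  Eval (g ⋆q u)       = dedup (map (λ p → proj₁ p Q.* proj₂ p) (cartesianProduct (Eval g) (Eval u)))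
  Eval (φ -⋆q g)      = Eval g

-- Finite disjunction ⋁ {φ₁,…,φₖ} = φ₁ ∨ (φ₂ ∨ … ∨ φₖ).  The empty case never
-- arises for α ≤ 1 (the pair (1,1) always qualifies); ¬true is a placeholder.
⋁ : ∀ {A Var} → List (SL A Var) → SL A Var
⋁ []           = ¬ₛ true
⋁ (φ ∷ [])     = φ
⋁ (φ ∷ ψ ∷ φs) = φ ∨ₛ ⋁ (ψ ∷ φs)

-- minimum of a list, with a default for the (never occurring) empty case
minimumOr : ℚ → List ℚ → ℚ
minimumOr d []       = d
minimumOr d (x ∷ xs) = foldr _⊓_ x xs

module _ {A Var : Set} {Pure : SL A Var → Set} where

  goodPairs : (ℚ → ℚ → ℚ) → ℚ → QSL A Var Pure → QSL A Var Pure → List (ℚ × ℚ)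
  goodPairs h α g u = filter (λ p → α ≤? h (proj₁ p) (proj₂ p)) (cartesianProduct (Eval g) (Eval u))

  atleast : ℚ → QSL A Var Pure → SL A Var
  atleast α ⟦ φ ⟧ with α ≟ 0ℚ
  ... | yes _ = true
  ... | no _  = φ
  atleast α (cond b _ g u) = (b ∧ₛ atleast α g) ∨ₛ ((¬ₛ b) ∧ₛ atleast α u)
  atleast α (mix q g u) =
    ⋁ (map (λ p → atleast (proj₁ p) g ∧ₛ atleast (proj₂ p) u)
           (goodPairs (λ β γ → val q Q.* β Q.+ (1ℚ Q.- val q) Q.* γ) α g u))
  atleast α (g · u) =
    ⋁ (map (λ p → atleast (proj₁ p) g ∧ₛ atleast (proj₂ p) u) (goodPairs Q._*_ α g u))
  atleast α (1- g) with α ≟ 0ℚ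
  ... | yes _ = true
  ... | no _  = ¬ₛ atleast (minimumOr 1ℚ (filter (λ β → (1ℚ Q.- α) <? β) (Eval g))) g
  atleast α (max g u) = atleast α g ∨ₛ atleast α u
  atleast α (min g u) = atleast α g ∧ₛ atleast α u
  atleast α (S x g)   = ∃ₛ x (atleast α g)
  atleast α (J x g)   = ∀ₛ x (atleast α g)
  atleast α (g ⋆q u) =
    ⋁ (map (λ p → atleast (proj₁ p) g ⋆ atleast (proj₂ p) u) (goodPairs Q._*_ α g u))
  atleast α (φ -⋆q g) = φ -⋆ atleast α g

{-# OPTIONS --safe #-}
-- Every evaluation set Eval f contains 0 and 1 and has at most 2^(|f|_p + 1) elements: the
-- bounds multiply at probabilistic nodes, and at a union the two shared values 0 and 1 save
-- exactly what 2^(a+1) + 2^(b+1) − 2 ≤ 2^(a+b+1) needs. At a probabilistic node with |g|_p + |u|_p = n the disjunction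
-- ranges over at most 2^(n+2) pairs of values; a factor 2·2^(n+2) is paid for by the exponent
-- growing from (n+1)^2 to (n+2)^2 = (n+1)^2 + (n+2) + (n+1).
module Submission where

open import Defs
open import Data.Nat using (ℕ; suc; _≤_; _*_; _+_; _^_; z≤n; s≤s; NonZero)
open import Data.Nat.Properties
  using (≤-refl; ≤-reflexive; ≤-trans; +-mono-≤; +-monoʳ-≤; *-mono-≤; *-monoʳ-≤; *-monoˡ-≤; m≤m+n; m≤n+m; m≤m*n; m≤n*m
        ; +-comm; +-suc; +-monoˡ-≤; +-cancelˡ-≤; *-distribˡ-+; *-distribʳ-+; *-identityʳ; ^-distribˡ-+-*; ^-monoʳ-≤
        ; ^-monoˡ-≤; m^n≢0; module ≤-Reasoning)
open import Data.Nat.Tactic.RingSolver using (solve-∀)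
open import Data.Rational as Q using (ℚ; 0ℚ; 1ℚ)
import Data.Rational.Properties as QP
open import Data.List using (List; []; _∷_; length; map; _++_; cartesianProduct; cartesianProductWith; deduplicate)
open import Data.List.Properties using (length-++; length-map; length-filter; length-deduplicate; length-removeAt′)
open import Data.List.Membership.Propositional using (_∈_)
open import Data.List.Membership.Propositional.Properties
  using (∈-deduplicate⁺; ∈-deduplicate⁻; ∈-++⁺ˡ; ∈-++⁺ʳ; ∈-++⁻; ∈-map⁺; ∈-cartesianProductWith⁺)
open import Data.List.Relation.Unary.Any using (here; there; _─_)
import Data.List.Relation.Unary.All as All
open import Data.List.Relation.Unary.AllPairs using (_∷_)
open import Data.List.Relation.Binary.Subset.Propositional using (_⊆_)
open import Data.List.Relation.Unary.Unique.Propositional using (Unique)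
open import Data.Product using (_×_; _,_; proj₁; proj₂)
open import Data.Sum using (inj₁; inj₂)
open import Data.Empty using (⊥-elim)
open import Relation.Nullary using (yes; no)
open import Function using (_∘_)
open import Relation.Binary.PropositionalEquality
open import Relation.Binary.Definitions using (DecidableEquality)
import Data.List.Relation.Unary.Unique.DecPropositional.Properties as UniqueDec

∈-─⁺ : ∀ {A : Set} {x y : A} {ys} (p : x ∈ ys) → y ∈ ys → y ≢ x → y ∈ (ys ─ p)
∈-─⁺ (here refl) (here refl) y≢x = ⊥-elim (y≢x refl)
∈-─⁺ (here _)    (there q)   _   = q
∈-─⁺ (there _)   (here y≡z)  _   = here y≡z
∈-─⁺ (there p)   (there q)   y≢x = there (∈-─⁺ p q y≢x)

unique-⊆⇒length≤ : ∀ {A : Set} {xs ys : List A} → Unique xs → xs ⊆ ys → length xs ≤ length ys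
unique-⊆⇒length≤ {xs = []} _ _ = z≤n
unique-⊆⇒length≤ {xs = x ∷ xs} {ys} (x∉xs ∷ !xs) xs⊆ys =
  subst (suc (length xs) ≤_) (sym (length-removeAt′ ys _))
    (s≤s (unique-⊆⇒length≤ !xs λ z∈xs →
      ∈-─⁺ x∈ys (xs⊆ys (there z∈xs)) λ z≡x → All.lookup x∉xs z∈xs (sym z≡x)))
  where x∈ys = xs⊆ys (here refl)

length-cartesianProductWith : ∀ {A B C : Set} (f : A → B → C) xs ys →
  length (cartesianProductWith f xs ys) ≡ length xs * length ys
length-cartesianProductWith f []       ys = refl
length-cartesianProductWith f (x ∷ xs) ys = begin
  length (map (f x) ys ++ cartesianProductWith f xs ys)
    ≡⟨ length-++ (map (f x) ys) ⟩
  length (map (f x) ys) + length (cartesianProductWith f xs ys)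
    ≡⟨ cong₂ _+_ (length-map (f x) ys) (length-cartesianProductWith f xs ys) ⟩
  length ys + length xs * length ys
    ∎
  where open ≡-Reasoning

module _ {A : Set} (_≟_ : DecidableEquality A) where

  length-deduplicate-++-shared : ∀ {a b : A} {xs ys} → b ≢ a →
    a ∈ xs → b ∈ xs → a ∈ ys → b ∈ ys →
    2 + length (deduplicate _≟_ (xs ++ ys)) ≤ length xs + length ys
  length-deduplicate-++-shared {a} {b} {xs} {ys} b≢a a∈xs b∈xs a∈ys b∈ys = begin
    2 + length (deduplicate _≟_ (xs ++ ys))
      ≤⟨ +-monoʳ-≤ 2 (unique-⊆⇒length≤ (UniqueDec.deduplicate-! _≟_ (xs ++ ys)) union⊆) ⟩
    2 + length (xs ++ rest)
      ≡⟨ cong (2 +_) (length-++ xs) ⟩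
    2 + (length xs + length rest)
      ≡⟨ sym (trans (+-suc (length xs) _) (cong suc (+-suc (length xs) _))) ⟩
    length xs + (2 + length rest)
      ≡⟨ cong (length xs +_) (sym length-rest) ⟩
    length xs + length ys
      ∎
    where
    open ≤-Reasoning
    b∈ys─a = ∈-─⁺ a∈ys b∈ys b≢a
    rest = (ys ─ a∈ys) ─ b∈ys─a
    length-rest : length ys ≡ 2 + length rest
    length-rest = trans (length-removeAt′ ys _) (cong suc (length-removeAt′ (ys ─ a∈ys) _))
    union⊆ : deduplicate _≟_ (xs ++ ys) ⊆ xs ++ rest
    union⊆ {z} z∈ with ∈-++⁻ xs (∈-deduplicate⁻ _≟_ (xs ++ ys) z∈)
    ... | inj₁ z∈xs = ∈-++⁺ˡ z∈xs
    ... | inj₂ z∈ys with z ≟ a | z ≟ b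
    ... | yes refl | _        = ∈-++⁺ˡ a∈xs
    ... | no _     | yes refl = ∈-++⁺ˡ b∈xs
    ... | no z≢a   | no z≢b   = ∈-++⁺ʳ xs (∈-─⁺ b∈ys─a (∈-─⁺ a∈ys z∈ys z≢a) z≢b)

2^[1+m]*2^[1+n]≡2^[2+m+n] : ∀ m n → 2 ^ suc m * 2 ^ suc n ≡ 2 ^ suc (suc (m + n))
2^[1+m]*2^[1+n]≡2^[2+m+n] m n =
  trans (sym (^-distribˡ-+-* 2 (suc m) (suc n))) (cong (λ k → 2 ^ suc k) (+-suc m n))

2^[1+m]+2^[1+n]≤2+2^[1+m+n] : ∀ m n → 2 ^ suc m + 2 ^ suc n ≤ 2 + 2 ^ suc (m + n)
2^[1+m]+2^[1+n]≤2+2^[1+m+n] m n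
  rewrite ^-distribˡ-+-* 2 m n = doubled-sum≤ (2 ^ m) (2 ^ n) {{m^n≢0 2 m}} {{m^n≢0 2 n}}
  where
  -- (x − 1)(y − 1) ≥ 0, doubled
  doubled-sum≤ : ∀ x y .{{_ : NonZero x}} .{{_ : NonZero y}} → 2 * x + 2 * y ≤ 2 + 2 * (x * y)
  doubled-sum≤ (suc x) (suc y) = subst (2 * suc x + 2 * suc y ≤_) (expand x y) (m≤m+n _ (2 * (x * y)))
    where
    expand : ∀ x y → 2 * (1 + x) + 2 * (1 + y) + 2 * (x * y) ≡ 2 + 2 * ((1 + x) * (1 + y))
    expand = solve-∀

record Spectrum (xs : List ℚ) (n : ℕ) : Set where
  field
    0∈      : 0ℚ ∈ xs
    1∈      : 1ℚ ∈ xs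
    length≤ : length xs ≤ 2 ^ suc n
open Spectrum

0≢1 : 0ℚ ≢ 1ℚ
0≢1 ()

spectrum-union : ∀ {xs ys a b} → Spectrum xs a → Spectrum ys b → Spectrum (dedup (xs ++ ys)) (a + b)
spectrum-union {xs} {ys} {a} {b} sx sy = record
  { 0∈      = ∈-deduplicate⁺ QP._≟_ (∈-++⁺ˡ (0∈ sx))
  ; 1∈      = ∈-deduplicate⁺ QP._≟_ (∈-++⁺ˡ (1∈ sx))
  ; length≤ = +-cancelˡ-≤ 2 _ _ (begin
      2 + length (dedup (xs ++ ys))
        ≤⟨ length-deduplicate-++-shared QP._≟_ (0≢1 ∘ sym) (0∈ sx) (1∈ sx) (0∈ sy) (1∈ sy) ⟩
      length xs + length ys
        ≤⟨ +-mono-≤ (length≤ sx) (length≤ sy) ⟩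
      2 ^ suc a + 2 ^ suc b
        ≤⟨ 2^[1+m]+2^[1+n]≤2+2^[1+m+n] a b ⟩
      2 + 2 ^ suc (a + b)
        ∎)
  }
  where open ≤-Reasoning

spectrum-product : ∀ {xs ys a b} (h : ℚ → ℚ → ℚ) → h 0ℚ 0ℚ ≡ 0ℚ → h 1ℚ 1ℚ ≡ 1ℚ →
  Spectrum xs a → Spectrum ys b →
  Spectrum (dedup (map (λ p → h (proj₁ p) (proj₂ p)) (cartesianProduct xs ys))) (suc (a + b))
spectrum-product {xs} {ys} {a} {b} h h00 h11 sx sy = record
  { 0∈      = value h00 (0∈ sx) (0∈ sy)
  ; 1∈      = value h11 (1∈ sx) (1∈ sy)
  ; length≤ = begin
      length (dedup pairs)                   ≤⟨ length-deduplicate QP._≟_ pairs ⟩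
      length pairs                           ≡⟨ length-map h′ (cartesianProduct xs ys) ⟩
      length (cartesianProduct xs ys)        ≡⟨ length-cartesianProductWith _,_ xs ys ⟩
      length xs * length ys                  ≤⟨ *-mono-≤ (length≤ sx) (length≤ sy) ⟩
      2 ^ suc a * 2 ^ suc b                  ≡⟨ 2^[1+m]*2^[1+n]≡2^[2+m+n] a b ⟩
      2 ^ suc (suc (a + b))                  ∎
  }
  where
  open ≤-Reasoning
  h′ = λ (p : ℚ × ℚ) → h (proj₁ p) (proj₂ p)
  pairs = map h′ (cartesianProduct xs ys)
  value : ∀ {β γ δ} → h β γ ≡ δ → β ∈ xs → γ ∈ ys → δ ∈ dedup pairs
  value refl β∈ γ∈ = ∈-deduplicate⁺ QP._≟_ (∈-map⁺ h′ (∈-cartesianProductWith⁺ _,_ β∈ γ∈))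

spectrum-complement : ∀ {xs a} → Spectrum xs a → Spectrum (dedup (map (λ β → 1ℚ Q.- β) xs)) a
spectrum-complement {xs} sx = record
  { 0∈      = ∈-deduplicate⁺ QP._≟_ (∈-map⁺ complement (1∈ sx))
  ; 1∈      = ∈-deduplicate⁺ QP._≟_ (∈-map⁺ complement (0∈ sx))
  ; length≤ = ≤-trans (length-deduplicate QP._≟_ (map complement xs))
                (subst (_≤ _) (sym (length-map complement xs)) (length≤ sx))
  }
  where complement = λ β → 1ℚ Q.- β

interpolate-0 : ∀ q → q Q.* 0ℚ Q.+ (1ℚ Q.- q) Q.* 0ℚ ≡ 0ℚ
interpolate-0 q rewrite QP.*-zeroʳ q | QP.*-zeroʳ (1ℚ Q.- q) = refl

interpolate-1 : ∀ q → q Q.* 1ℚ Q.+ (1ℚ Q.- q) Q.* 1ℚ ≡ 1ℚ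
interpolate-1 q = begin
  q Q.* 1ℚ Q.+ (1ℚ Q.- q) Q.* 1ℚ   ≡⟨ cong₂ Q._+_ (QP.*-identityʳ q) (QP.*-identityʳ (1ℚ Q.- q)) ⟩
  q Q.+ (1ℚ Q.- q)                 ≡⟨ cong (q Q.+_) (QP.+-comm 1ℚ (Q.- q)) ⟩
  q Q.+ (Q.- q Q.+ 1ℚ)             ≡⟨ sym (QP.+-assoc q (Q.- q) 1ℚ) ⟩
  q Q.- q Q.+ 1ℚ                   ≡⟨ cong (Q._+ 1ℚ) (QP.+-inverseʳ q) ⟩
  0ℚ Q.+ 1ℚ                        ≡⟨ QP.+-identityˡ 1ℚ ⟩
  1ℚ                               ∎
  where open ≡-Reasoning

module _ {A Var : Set} {Pure : SL A Var → Set} where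

  Eval-spectrum : (f : QSL A Var Pure) → Spectrum (Eval f) (psize f)
  Eval-spectrum ⟦ φ ⟧          = record { 0∈ = here refl ; 1∈ = there (here refl) ; length≤ = ≤-refl }
  Eval-spectrum (cond b _ g u) = spectrum-union (Eval-spectrum g) (Eval-spectrum u)
  Eval-spectrum (mix q g u)    = spectrum-product (λ β γ → val q Q.* β Q.+ (1ℚ Q.- val q) Q.* γ)
                                   (interpolate-0 (val q)) (interpolate-1 (val q))
                                   (Eval-spectrum g) (Eval-spectrum u)
  Eval-spectrum (g · u)        = spectrum-product Q._*_ refl refl (Eval-spectrum g) (Eval-spectrum u)
  Eval-spectrum (1- g)         = spectrum-complement (Eval-spectrum g)
  Eval-spectrum (max g u)      = spectrum-union (Eval-spectrum g) (Eval-spectrum u)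
  Eval-spectrum (min g u)      = spectrum-union (Eval-spectrum g) (Eval-spectrum u)
  Eval-spectrum (S _ g)        = Eval-spectrum g
  Eval-spectrum (J _ g)        = Eval-spectrum g
  Eval-spectrum (g ⋆q u)       = spectrum-product Q._*_ refl refl (Eval-spectrum g) (Eval-spectrum u)
  Eval-spectrum (_ -⋆q g)      = Eval-spectrum g

  length-goodPairs : ∀ h α (g u : QSL A Var Pure) →
    length (goodPairs h α g u) ≤ 2 ^ suc (suc (psize g + psize u))
  length-goodPairs h α g u = begin
    length (goodPairs h α g u)                 ≤⟨ length-filter _ (cartesianProduct (Eval g) (Eval u)) ⟩
    length (cartesianProduct (Eval g) (Eval u)) ≡⟨ length-cartesianProductWith _,_ (Eval g) (Eval u) ⟩
    length (Eval g) * length (Eval u)          ≤⟨ *-mono-≤ (length≤ (Eval-spectrum g)) (length≤ (Eval-spectrum u)) ⟩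
    2 ^ suc (psize g) * 2 ^ suc (psize u)      ≡⟨ 2^[1+m]*2^[1+n]≡2^[2+m+n] (psize g) (psize u) ⟩
    2 ^ suc (suc (psize g + psize u))          ∎
    where open ≤-Reasoning

blowup : ℕ → ℕ
blowup n = 2 ^ ((n + 1) ^ 2)

blowup-nonZero : ∀ n → NonZero (blowup n)
blowup-nonZero n = m^n≢0 2 ((n + 1) ^ 2)

blowup-mono-≤ : ∀ {m n} → m ≤ n → blowup m ≤ blowup n
blowup-mono-≤ m≤n = ^-monoʳ-≤ 2 (^-monoˡ-≤ 2 (+-monoˡ-≤ 1 m≤n))

blowup-step : ∀ n → blowup n * 2 ^ suc (suc n) * 2 ≤ blowup (suc n)
blowup-step n = begin
  blowup n * 2 ^ suc (suc n) * 2                ≤⟨ *-monoʳ-≤ (blowup n * 2 ^ suc (suc n)) (^-monoʳ-≤ 2 (m≤n+m 1 n)) ⟩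
  blowup n * 2 ^ suc (suc n) * 2 ^ (n + 1)      ≡⟨ cong (_* 2 ^ (n + 1)) (sym (^-distribˡ-+-* 2 ((n + 1) ^ 2) (suc (suc n)))) ⟩
  2 ^ ((n + 1) ^ 2 + suc (suc n)) * 2 ^ (n + 1) ≡⟨ sym (^-distribˡ-+-* 2 ((n + 1) ^ 2 + suc (suc n)) (n + 1)) ⟩
  2 ^ ((n + 1) ^ 2 + suc (suc n) + (n + 1))     ≡⟨ cong (2 ^_) (sym square-step) ⟩
  blowup (suc n)                                ∎
  where
  open ≤-Reasoning
  square : ∀ x → x ^ 2 ≡ x * x
  square x = cong (x *_) (*-identityʳ x)
  expand : ∀ n → (1 + n + 1) * (1 + n + 1) ≡ (n + 1) * (n + 1) + (2 + n) + (n + 1)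
  expand = solve-∀
  square-step : (suc n + 1) ^ 2 ≡ (n + 1) ^ 2 + suc (suc n) + (n + 1)
  square-step = trans (square (suc n + 1))
    (trans (expand n) (cong (λ x → x + suc (suc n) + (n + 1)) (sym (square (n + 1)))))

≤-scale : ∀ {c} d n → c ≤ 3 * d → c ≤ 3 * d * blowup n
≤-scale d n c≤3d = ≤-trans c≤3d (m≤m*n (3 * d) (blowup n) {{blowup-nonZero n}})

+-bound : ∀ {x y} s t k → x ≤ 3 * s * k → y ≤ 3 * t * k → x + y ≤ 3 * (s + t) * k
+-bound {x} {y} s t k x≤ y≤ = begin
  x + y                 ≤⟨ +-mono-≤ x≤ y≤ ⟩
  3 * s * k + 3 * t * k ≡⟨ sym (*-distribʳ-+ k (3 * s) (3 * t)) ⟩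
  (3 * s + 3 * t) * k   ≡⟨ cong (_* k) (sym (*-distribˡ-+ 3 s t)) ⟩
  3 * (s + t) * k       ∎
  where open ≤-Reasoning

suc-bound : ∀ {x} s n → x ≤ 3 * s * blowup n → suc x ≤ 3 * suc s * blowup n
suc-bound s n = +-bound 1 s (blowup n) (≤-scale 1 n (s≤s z≤n))

cond-bound : ∀ {x y s t} b n → x + y ≤ 3 * (s + t) * blowup n →
  suc (suc (b + x) + suc (suc b + y)) ≤ 3 * suc (b + s + suc b + t) * blowup n
cond-bound {x} {y} {s} {t} b n x+y≤ =
  subst₂ _≤_ (formula-size b x y) (cong (λ m → 3 * m * blowup n) (size-cond b s t))
    (+-bound (2 + 2 * b) (s + t) (blowup n) (≤-scale (2 + 2 * b) n 4+2b≤3[2+2b]) x+y≤)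
  where
  formula-size : ∀ b x y → 4 + 2 * b + (x + y) ≡ 1 + ((1 + (b + x)) + (1 + (1 + b + y)))
  formula-size = solve-∀
  size-cond : ∀ b s t → 2 + 2 * b + (s + t) ≡ 1 + (b + s + (1 + b) + t)
  size-cond = solve-∀
  slack : ∀ b → 4 + 2 * b + (2 + 4 * b) ≡ 3 * (2 + 2 * b)
  slack = solve-∀
  4+2b≤3[2+2b] : 4 + 2 * b ≤ 3 * (2 + 2 * b)
  4+2b≤3[2+2b] = subst (4 + 2 * b ≤_) (slack b) (m≤m+n (4 + 2 * b) (2 + 4 * b))

⋁-bound : ∀ s T k K′ .{{_ : NonZero T}} .{{_ : NonZero k}} → k * T * 2 ≤ K′ →
  2 + T * (2 + 3 * s * k) ≤ 3 * suc s * K′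
⋁-bound s T@(suc t) k@(suc j) K′ kT2≤K′ = begin
  2 + T * (2 + 3 * s * k) ≤⟨ subst (2 + T * (2 + 3 * s * k) ≤_) (slack s t j) (m≤m+n _ surplus) ⟩
  3 * suc s * (k * T * 2) ≤⟨ *-monoʳ-≤ (3 * suc s) kT2≤K′ ⟩
  3 * suc s * K′          ∎
  where
  open ≤-Reasoning
  surplus = 2 + 6 * j + 4 * t + 6 * j * t + 3 * s * (k * T)
  slack : ∀ s t j →
    2 + (1 + t) * (2 + 3 * s * (1 + j)) + (2 + 6 * j + 4 * t + 6 * j * t + 3 * s * ((1 + j) * (1 + t)))
      ≡ 3 * (1 + s) * ((1 + j) * (1 + t) * 2)
  slack = solve-∀

1≤sizeSL : ∀ {A Var} (φ : SL A Var) → 1 ≤ sizeSL φ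
1≤sizeSL true     = s≤s z≤n
1≤sizeSL (atom _) = s≤s z≤n
1≤sizeSL (¬ₛ _)   = s≤s z≤n
1≤sizeSL (_ ∧ₛ _) = s≤s z≤n
1≤sizeSL (_ ∨ₛ _) = s≤s z≤n
1≤sizeSL (∃ₛ _ _) = s≤s z≤n
1≤sizeSL (∀ₛ _ _) = s≤s z≤n
1≤sizeSL (_ ⋆ _)  = s≤s z≤n
1≤sizeSL (_ -⋆ _) = s≤s z≤n

sizeSL-⋁ : ∀ {A Var} {X : Set} (F : X → SL A Var) c ps →
  (∀ p → sizeSL (F p) ≤ c) → sizeSL (⋁ (map F ps)) ≤ 2 + length ps * suc c
sizeSL-⋁ F c []           F≤ = ≤-refl
sizeSL-⋁ F c (p ∷ [])     F≤ = ≤-trans (F≤ p) (≤-trans (m≤m+n c 3) (≤-reflexive (solve c)))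
  where
  solve : ∀ c → c + 3 ≡ 2 + 1 * suc c
  solve = solve-∀
sizeSL-⋁ F c (p ∷ q ∷ ps) F≤ =
  ≤-trans (s≤s (+-mono-≤ (F≤ p) (sizeSL-⋁ F c (q ∷ ps) F≤))) (≤-reflexive (solve c (length ps)))
  where
  solve : ∀ c l → suc (c + (2 + (1 + l) * suc c)) ≡ 2 + (2 + l) * suc c
  solve = solve-∀

blowup-+-bound : ∀ {x y} s t a b → x ≤ 3 * s * blowup a → y ≤ 3 * t * blowup b →
  x + y ≤ 3 * (s + t) * blowup (a + b)
blowup-+-bound s t a b x≤ y≤ =
  +-bound s t (blowup (a + b)) (≤-trans x≤ (*-monoʳ-≤ (3 * s) (blowup-mono-≤ (m≤m+n a b))))
          (≤-trans y≤ (*-monoʳ-≤ (3 * t) (blowup-mono-≤ (m≤n+m b a))))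

module _ {A Var : Set} {Pure : SL A Var → Set} where

  SizeBounded : QSL A Var Pure → Set
  SizeBounded f = ∀ α → sizeSL (atleast α f) ≤ 3 * size f * blowup (psize f)

  +-sizeBounded : ∀ g u → SizeBounded g → SizeBounded u → ∀ β γ →
    sizeSL (atleast β g) + sizeSL (atleast γ u) ≤ 3 * (size g + size u) * blowup (psize g + psize u)
  +-sizeBounded g u g-bounded u-bounded β γ =
    blowup-+-bound (size g) (size u) (psize g) (psize u) (g-bounded β) (u-bounded γ)

  pairwise-bounded : (_⊕_ : SL A Var → SL A Var → SL A Var) →
    (∀ φ ψ → sizeSL (φ ⊕ ψ) ≤ suc (sizeSL φ + sizeSL ψ)) →
    ∀ h α (g u : QSL A Var Pure) → SizeBounded g → SizeBounded u →
    sizeSL (⋁ (map (λ p → atleast (proj₁ p) g ⊕ atleast (proj₂ p) u) (goodPairs h α g u)))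
      ≤ 3 * suc (size g + size u) * blowup (suc (psize g + psize u))
  pairwise-bounded _⊕_ ⊕-size h α g u g-bounded u-bounded = begin
    sizeSL (⋁ (map disjunct pairs))         ≤⟨ sizeSL-⋁ disjunct _ pairs disjunct-size ⟩
    2 + length pairs * (2 + 3 * s * k)     ≤⟨ +-monoʳ-≤ 2 (*-monoˡ-≤ _ (length-goodPairs h α g u)) ⟩
    2 + 2 ^ suc (suc n) * (2 + 3 * s * k)
      ≤⟨ ⋁-bound s _ k _ {{m^n≢0 2 (suc (suc n))}} {{blowup-nonZero n}} (blowup-step n) ⟩
    3 * suc s * blowup (suc n)             ∎
    where
    open ≤-Reasoning
    n = psize g + psize u
    s = size g + size u
    k = blowup n
    pairs = goodPairs h α g u
    disjunct = λ (p : ℚ × ℚ) → atleast (proj₁ p) g ⊕ atleast (proj₂ p) u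
    disjunct-size : ∀ p → sizeSL (disjunct p) ≤ suc (3 * s * k)
    disjunct-size (β , γ) =
      ≤-trans (⊕-size _ _) (s≤s (+-sizeBounded g u g-bounded u-bounded β γ))

  atleast-size-bounded : (f : QSL A Var Pure) → SizeBounded f
  atleast-size-bounded ⟦ φ ⟧ α with α QP.≟ 0ℚ
  ... | yes _ = ≤-scale (sizeSL φ) 0 (≤-trans (1≤sizeSL φ) (m≤n*m (sizeSL φ) 3))
  ... | no _  = ≤-scale (sizeSL φ) 0 (m≤n*m (sizeSL φ) 3)
  atleast-size-bounded (cond b _ g u) α =
    cond-bound (sizeSL b) (psize g + psize u)
      (+-sizeBounded g u (atleast-size-bounded g) (atleast-size-bounded u) α α)
  atleast-size-bounded (mix _ g u) α =
    pairwise-bounded _∧ₛ_ (λ _ _ → ≤-refl) _ α g u (atleast-size-bounded g) (atleast-size-bounded u)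
  atleast-size-bounded (g · u) α =
    pairwise-bounded _∧ₛ_ (λ _ _ → ≤-refl) Q._*_ α g u (atleast-size-bounded g) (atleast-size-bounded u)
  atleast-size-bounded (1- g) α with α QP.≟ 0ℚ
  ... | yes _ = ≤-scale (suc (size g)) (psize g) (s≤s z≤n)
  ... | no _  = suc-bound (size g) (psize g) (atleast-size-bounded g _)
  atleast-size-bounded (max g u) α =
    suc-bound (size g + size u) (psize g + psize u)
      (+-sizeBounded g u (atleast-size-bounded g) (atleast-size-bounded u) α α)
  atleast-size-bounded (min g u) α =
    suc-bound (size g + size u) (psize g + psize u)
      (+-sizeBounded g u (atleast-size-bounded g) (atleast-size-bounded u) α α)
  atleast-size-bounded (S _ g) α = suc-bound (size g) (psize g) (atleast-size-bounded g α)
  atleast-size-bounded (J _ g) α = suc-bound (size g) (psize g) (atleast-size-bounded g α)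
  atleast-size-bounded (g ⋆q u) α =
    pairwise-bounded _⋆_ (λ _ _ → ≤-refl) Q._*_ α g u (atleast-size-bounded g) (atleast-size-bounded u)
  atleast-size-bounded (φ -⋆q g) α =
    subst (λ m → suc (sizeSL φ + sizeSL (atleast α g)) ≤ 3 * m * blowup (psize g))
      (cong suc (+-comm (sizeSL φ) (size g)))
      (+-bound (suc (sizeSL φ)) (size g) (blowup (psize g))
        (≤-scale (suc (sizeSL φ)) (psize g) (m≤n*m (suc (sizeSL φ)) 3))
        (atleast-size-bounded g α))

mainTheorem6 : {A Var : Set} {Pure : SL A Var → Set}
    (f : QSL A Var Pure) (α : ℚ) → 0ℚ Q.≤ α → α Q.≤ 1ℚ →
    sizeSL (atleast α f) ≤ 3 * size f * 2 ^ ((psize f + 1) ^ 2)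
mainTheorem6 f α _ _ = atleast-size-bounded f α
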